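{- Let $A$ and $B$ be finite sets of real numbers with $|A| = k$ and $|B| = \ell$. Write $A=\{a_1,a_2,\ldots,a_k\}$ with $a_1<a_2<\cdots<a_k$, and suppose that $A$ has distinct consecutive differences, i.e. for $1\le i,j\le k-1$, $a_{i+1}-a_i=a_{j+1}-a_j$ implies $i=j$. Then \[ |A+B| \geq \frac{k\sqrt{\ell}}{3}. \] In particular, if $k=\ell$, then $|A+B|\geq \frac{k^{3/2}}{3}$.
   Context: For sets of real numbers $A,B$, the sumset is $A+B=\{a+b : a\in A,\ b\in B\}$. -}

module Defs where

open import Data.Nat as ℕ using (ℕ; suc; _*_; _≤_)
open import Data.Fin as Fin using (Fin; fromℕ<)
open import Data.Product using (Σ; ∃; _×_; _,_)
open import Data.Sum using (_⊎_)
open import Data.List using (List; length)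
open import Data.List.Membership.Propositional using (_∈_)
open import Data.List.Relation.Unary.Unique.Propositional using (Unique)
open import Relation.Nullary using (¬_)
open import Relation.Binary.PropositionalEquality using (_≡_)
open import Algebra.Structures using (IsCommutativeRing)
open import Relation.Binary.Structures using (IsStrictTotalOrder)
open import Function using (Injective)
open import Data.Nat.Properties using (<-trans; n<1+n)

-- An axiomatisation of the real numbers: a complete ordered field
-- (unique up to isomorphism).  Equality is propositional equality.
record RealNumbers : Set₁ where
  infixl 6 _+_
  infixl 7 _·_
  infix 4 _<_ _≤ᵣ_
  field
    Carrier : Set
    _+_ _·_ : Carrier → Carrier → Carrier
    -_      : Carrier → Carrier
    0ᵣ 1ᵣ   : Carrier
    _<_     : Carrier → Carrier → Set
    isCommutativeRing : IsCommutativeRing _≡_ _+_ _·_ -_ 0ᵣ 1ᵣ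
    0≢1     : ¬ (0ᵣ ≡ 1ᵣ)
    inverse : ∀ x → ¬ (x ≡ 0ᵣ) → Σ Carrier (λ y → x · y ≡ 1ᵣ)
    isStrictTotalOrder : IsStrictTotalOrder _≡_ _<_
    +-mono-< : ∀ {x y} z → x < y → x + z < y + z
    ·-pos    : ∀ {x y} → 0ᵣ < x → 0ᵣ < y → 0ᵣ < x · y

  _≤ᵣ_ : Carrier → Carrier → Set
  x ≤ᵣ y = x < y ⊎ x ≡ y

  _-_ : Carrier → Carrier → Carrier
  x - y = x + (- y)

  field
    complete : (P : Carrier → Set) → ∃ P → (∃ λ u → ∀ x → P x → x ≤ᵣ u) →
               ∃ λ s → (∀ x → P x → x ≤ᵣ s) × (∀ u → (∀ x → P x → x ≤ᵣ u) → s ≤ᵣ u)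

module _ (ℝ : RealNumbers) where
  open RealNumbers ℝ

  -- a : Fin k → ℝ lists A = {a₁ < a₂ < … < a_k}
  StrictlyIncreasing : ∀ {k} → (Fin k → Carrier) → Set
  StrictlyIncreasing a = ∀ i j → i Fin.< j → a i < a j

  -- consecutive difference a_{i+1} - a_i (0-based index i, with i+1 < k)
  consecDiff : ∀ {k} → (Fin k → Carrier) → (i : ℕ) → suc i ℕ.< k → Carrier
  consecDiff a i p = a (fromℕ< p) - a (fromℕ< (<-trans (n<1+n i) p))

  DistinctConsecutiveDifferences : ∀ {k} → (Fin k → Carrier) → Set
  DistinctConsecutiveDifferences {k} a =
    ∀ i j (p : suc i ℕ.< k) (q : suc j ℕ.< k) → consecDiff a i p ≡ consecDiff a j q → i ≡ j

  EnumeratesSumset : ∀ {k l} → (Fin k → Carrier) → (Fin l → Carrier) → List Carrier → Set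
  EnumeratesSumset a b C =
    Unique C × (∀ x → (x ∈ C → ∃ λ i → ∃ λ j → x ≡ a i + b j) × (∀ i j → a i + b j ∈ C))

{-# OPTIONS --safe #-}
-- Rank the elements of A + B by their position in the sorted order of C, and write n = |C|.
-- For each b ∈ B the ranks of a₁ + b < ⋯ < a_k + b increase within [0, n), and a step
-- (rank (a_i + b), rank (a_{i+1} + b)) determines both sums, hence the difference a_{i+1} − a_i,
-- hence i and then b.  So the ℓ(k − 1) pairs (start, height) = (r_i, r_{i+1} − r_i − 1) are
-- distinct.  At most n of them share a height, so m distinct pairs have Σ (2h + 1) ≥ m² / n,
-- while telescoping along each row gives Σ (2h + 1) ≤ 2n per b.  Hence (ℓ(k − 1))² ≤ 2ℓn²,
-- i.e. (k − 1)² ℓ ≤ 2n², and so k² ℓ ≤ 9n².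
module Submission where

open import Algebra.Bundles using (AbelianGroup; CommutativeRing)
import Algebra.Properties.AbelianGroup as AbelianGroupProperties
import Algebra.Properties.CommutativeSemigroup as CommutativeSemigroupProperties
open import Data.Fin using (Fin; zero; suc; inject₁; fromℕ; fromℕ<; toℕ)
open import Data.Fin.Properties
  using (injective⇒≤; fromℕ<-injective; fromℕ<-toℕ; toℕ-fromℕ<; toℕ-inject₁; toℕ-injective; toℕ<n)
open import Data.List
  using (List; []; _∷_; length; lookup; map; _++_; filter; tabulate; allFin; cartesianProductWith)
open import Data.List.Properties
  using (map-++; map-tabulate; length-tabulate; length-++; length-map
        ; filter-notAll; filter-accept; filter-reject)
open import Data.List.Membership.Propositional using (_∈_)
open import Data.List.Membership.Propositional.Properties using (∈-lookup; ∈-cartesianProductWith⁻)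
open import Data.List.Relation.Binary.Sublist.Propositional using (⊆-refl)
open import Data.List.Relation.Binary.Sublist.Propositional.Properties using (filter⁺; length-mono-≤)
open import Data.List.Relation.Unary.All as All using (All; []; _∷_)
open import Data.List.Relation.Unary.AllPairs using ([]; _∷_)
open import Data.List.Relation.Unary.Any as Any using (here; there)
open import Data.List.Relation.Unary.Unique.Propositional using (Unique)
open import Data.List.Relation.Unary.Unique.Propositional.Properties using (cartesianProductWith⁺; allFin⁺)
open import Data.Nat as ℕ using (ℕ; zero; suc; _+_; _*_; _∸_; _≤_; _<_; z≤n; s≤s)
open import Data.Nat.ListAction using (sum)
open import Data.Nat.ListAction.Properties using (sum-++)
open import Data.Nat.Properties
  using ( ≤-refl; ≤-reflexive; ≤-trans; <⇒≤; <⇒≢; n≤1+n; m≤n⇒m≤1+n; m≤m+n; m≤n+m; m≤m*n; +-suc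
        ; *-zeroʳ; +-mono-≤; +-monoˡ-≤; +-monoʳ-≤; *-monoˡ-≤; *-monoʳ-≤; *-cancelˡ-≤; m+[n∸m]≡n
        ; module ≤-Reasoning)
open import Data.Nat.Tactic.RingSolver using (solve-∀)
open import Data.Product using (_×_; _,_; proj₁; proj₂)
open import Function using (_∘_; id; Injective)
open import Relation.Binary.Core using (Rel)
open import Relation.Binary.Definitions using (tri<; tri≈; tri>)
open import Relation.Binary.Structures using (IsStrictTotalOrder)
open import Relation.Binary.PropositionalEquality
  using (_≡_; _≢_; refl; sym; trans; cong; cong₂; subst; subst₂; module ≡-Reasoning)
open import Relation.Nullary using (yes; no; contradiction)

open import Defs

Unique⇒lookup-injective : ∀ {a} {A : Set a} {xs : List A} → Unique xs →
                          ∀ i j → lookup xs i ≡ lookup xs j → i ≡ j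
Unique⇒lookup-injective (_ ∷ _)         zero    zero    _  = refl
Unique⇒lookup-injective (x≢xs ∷ _)      zero    (suc j) eq = contradiction eq (All.lookup x≢xs (∈-lookup j))
Unique⇒lookup-injective (x≢xs ∷ _)      (suc i) zero    eq = contradiction (sym eq) (All.lookup x≢xs (∈-lookup i))
Unique⇒lookup-injective (_ ∷ xs-unique) (suc i) (suc j) eq = cong suc (Unique⇒lookup-injective xs-unique i j eq)

Unique∧All<⇒length≤ : ∀ {n} {xs : List ℕ} → Unique xs → All (_< n) xs → length xs ≤ n
Unique∧All<⇒length≤ {n} {xs} xs-unique xs<n = injective⇒≤ {f = toFin} toFin-injective
  where
  toFin : Fin (length xs) → Fin n
  toFin i = fromℕ< (All.lookup xs<n (∈-lookup i))
  toFin-injective : Injective _≡_ _≡_ toFin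
  toFin-injective eq = Unique⇒lookup-injective xs-unique _ _ (fromℕ<-injective _ _ _ _ eq)

weight : List (ℕ × ℕ) → ℕ
weight = sum ∘ map (λ (_ , h) → suc (2 * h))

weight-++ : ∀ ps qs → weight (ps ++ qs) ≡ weight ps + weight qs
weight-++ ps qs = trans (cong sum (map-++ _ ps qs)) (sum-++ (map _ ps) _)

heights<weight : ∀ (ps : List (ℕ × ℕ)) → All (λ (_ , h) → h < weight ps) ps
heights<weight []            = []
heights<weight ((_ , h) ∷ ps) =
  s≤s (≤-trans (m≤m+n h (h + 0)) (m≤m+n _ (weight ps)))
  ∷ All.map (λ h′<w → ≤-trans h′<w (m≤n+m _ _)) (heights<weight ps)

ground : List (ℕ × ℕ) → List ℕ
ground []                 = []
ground ((p , zero)  ∷ ps) = p ∷ ground ps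
ground ((p , suc h) ∷ ps) = ground ps

lower : List (ℕ × ℕ) → List (ℕ × ℕ)
lower []                 = []
lower ((p , zero)  ∷ ps) = lower ps
lower ((p , suc h) ∷ ps) = (p , h) ∷ lower ps

length-ground+lower : ∀ ps → length ps ≡ length (ground ps) + length (lower ps)
length-ground+lower []                 = refl
length-ground+lower ((p , zero)  ∷ ps) = cong suc (length-ground+lower ps)
length-ground+lower ((p , suc h) ∷ ps) =
  trans (cong suc (length-ground+lower ps)) (sym (+-suc _ _))

weight-ground+lower : ∀ ps →
  weight ps ≡ length (ground ps) + 2 * length (lower ps) + weight (lower ps)
weight-ground+lower []                 = refl
weight-ground+lower ((p , zero)  ∷ ps) = cong suc (weight-ground+lower ps)
weight-ground+lower ((p , suc h) ∷ ps) rewrite weight-ground+lower ps =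
  identity h (length (ground ps)) (length (lower ps)) (weight (lower ps))
  where
  identity : ∀ h g r w → suc (2 * suc h) + (g + 2 * r + w) ≡ g + 2 * suc r + (suc (2 * h) + w)
  identity = solve-∀

ground-∉ : ∀ {p} ps → All ((p , 0) ≢_) ps → All (p ≢_) (ground ps)
ground-∉ []                 []         = []
ground-∉ ((q , zero)  ∷ ps) (≢q ∷ ≢ps) = (≢q ∘ cong (_, 0)) ∷ ground-∉ ps ≢ps
ground-∉ ((q , suc h) ∷ ps) (_  ∷ ≢ps) = ground-∉ ps ≢ps

lower-∉ : ∀ {p h} ps → All ((p , suc h) ≢_) ps → All ((p , h) ≢_) (lower ps)
lower-∉ []                 []         = []
lower-∉ ((q , zero)  ∷ ps) (_  ∷ ≢ps) = lower-∉ ps ≢ps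
lower-∉ ((q , suc h) ∷ ps) (≢q ∷ ≢ps) = (≢q ∘ cong (λ (p , h) → p , suc h)) ∷ lower-∉ ps ≢ps

ground-unique : ∀ ps → Unique ps → Unique (ground ps)
ground-unique []                 []                 = []
ground-unique ((p , zero)  ∷ ps) (p∉ps ∷ ps-unique) = ground-∉ ps p∉ps ∷ ground-unique ps ps-unique
ground-unique ((p , suc h) ∷ ps) (_     ∷ ps-unique) = ground-unique ps ps-unique

lower-unique : ∀ ps → Unique ps → Unique (lower ps)
lower-unique []                 []                 = []
lower-unique ((p , zero)  ∷ ps) (_     ∷ ps-unique) = lower-unique ps ps-unique
lower-unique ((p , suc h) ∷ ps) (p∉ps ∷ ps-unique) = lower-∉ ps p∉ps ∷ lower-unique ps ps-unique

InBox : ℕ → ℕ → ℕ × ℕ → Set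
InBox n H (p , h) = p < n × h < H

ground-< : ∀ {n H} ps → All (InBox n H) ps → All (_< n) (ground ps)
ground-< []                 []                   = []
ground-< ((p , zero)  ∷ ps) ((p<n , _) ∷ ps-box) = p<n ∷ ground-< ps ps-box
ground-< ((p , suc h) ∷ ps) (_         ∷ ps-box) = ground-< ps ps-box

lower-InBox : ∀ {n H} ps → All (InBox n (suc H)) ps → All (InBox n H) (lower ps)
lower-InBox []                 []                       = []
lower-InBox ((p , zero)  ∷ ps) (_                ∷ ps-box) = lower-InBox ps ps-box
lower-InBox ((p , suc h) ∷ ps) ((p<n , s≤s h<H) ∷ ps-box) = (p<n , h<H) ∷ lower-InBox ps ps-box

[g+r]²≤n*[g+2r+w] : ∀ n g r w → g ≤ n → r * r ≤ n * w → (g + r) * (g + r) ≤ n * (g + 2 * r + w)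
[g+r]²≤n*[g+2r+w] n g r w g≤n r²≤nw = begin
  (g + r) * (g + r)               ≡⟨ expand g r ⟩
  g * g + 2 * (g * r) + r * r     ≤⟨ +-mono-≤ (+-mono-≤ (*-monoˡ-≤ g g≤n) (*-monoʳ-≤ 2 (*-monoˡ-≤ r g≤n)))
                                             r²≤nw ⟩
  n * g + 2 * (n * r) + n * w     ≡⟨ collect n g r w ⟩
  n * (g + 2 * r + w)             ∎
  where
  open ≤-Reasoning
  expand : ∀ g r → (g + r) * (g + r) ≡ g * g + 2 * (g * r) + r * r
  expand = solve-∀
  collect : ∀ n g r w → n * g + 2 * (n * r) + n * w ≡ n * (g + 2 * r + w)
  collect = solve-∀

length²≤*weight-InBox : ∀ {n} H ps → Unique ps → All (InBox n H) ps →
                        length ps * length ps ≤ n * weight ps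
length²≤*weight-InBox         zero    []      _ _                = z≤n
length²≤*weight-InBox         zero    (_ ∷ _) _ ((_ , ()) ∷ _)
length²≤*weight-InBox {n} (suc H) ps ps-unique ps-box
  rewrite length-ground+lower ps | weight-ground+lower ps =
  [g+r]²≤n*[g+2r+w] n _ _ _
    (Unique∧All<⇒length≤ (ground-unique ps ps-unique) (ground-< ps ps-box))
    (length²≤*weight-InBox H (lower ps) (lower-unique ps ps-unique) (lower-InBox ps ps-box))

length²≤*weight : ∀ {n} ps → Unique ps → All ((_< n) ∘ proj₁) ps →
                  length ps * length ps ≤ n * weight ps
length²≤*weight ps ps-unique ps<n =
  length²≤*weight-InBox (weight ps) ps ps-unique (All.zip (ps<n , heights<weight ps))

step : ∀ {K} → (Fin (suc K) → ℕ) → Fin K → ℕ × ℕ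
step f i = f (inject₁ i) , f (suc i) ∸ suc (f (inject₁ i))

stepEnd : ℕ × ℕ → ℕ
stepEnd (p , h) = suc (p + h)

stepEnd-step : ∀ {K} (f : Fin (suc K) → ℕ) i → f (inject₁ i) < f (suc i) →
               stepEnd (step f i) ≡ f (suc i)
stepEnd-step f i = m+[n∸m]≡n

weight-tabulate-step≤ : ∀ {K} (f : Fin (suc K) → ℕ) → (∀ i → f (inject₁ i) < f (suc i)) →
                        weight (tabulate (step f)) + 2 * f zero ≤ 2 * f (fromℕ K)
weight-tabulate-step≤ {zero}  f f-increasing = ≤-refl
weight-tabulate-step≤ {suc K} f f-increasing = begin
  suc (2 * h) + w + 2 * f zero       ≤⟨ n≤1+n _ ⟩
  suc (suc (2 * h) + w + 2 * f zero) ≡⟨ identity h w (f zero) ⟩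
  w + 2 * stepEnd (step f zero)      ≡⟨ cong (λ t → w + 2 * t) (stepEnd-step f zero (f-increasing zero)) ⟩
  w + 2 * f (suc zero)               ≤⟨ weight-tabulate-step≤ (f ∘ suc) (f-increasing ∘ suc) ⟩
  2 * f (fromℕ (suc K))              ∎
  where
  open ≤-Reasoning
  h = proj₂ (step f zero)
  w = weight (tabulate (step (f ∘ suc)))
  identity : ∀ h w f₀ → suc (suc (2 * h) + w + 2 * f₀) ≡ w + 2 * suc (f₀ + h)
  identity = solve-∀

length-allFin : ∀ n → length (allFin n) ≡ n
length-allFin n = length-tabulate {n = n} id

length-cartesianProductWith : ∀ {a b c} {A : Set a} {B : Set b} {C : Set c} (f : A → B → C) xs ys →
                              length (cartesianProductWith f xs ys) ≡ length xs * length ys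
length-cartesianProductWith f []       ys = refl
length-cartesianProductWith f (x ∷ xs) ys = begin
  length (map (f x) ys ++ cartesianProductWith f xs ys)
    ≡⟨ length-++ (map (f x) ys) ⟩
  length (map (f x) ys) + length (cartesianProductWith f xs ys)
    ≡⟨ cong₂ _+_ (length-map (f x) ys) (length-cartesianProductWith f xs ys) ⟩
  length ys + length xs * length ys
    ∎
  where open ≡-Reasoning

weight-cartesianProductWith≤ : ∀ {a b} {A : Set a} {B : Set b} (f : A → B → ℕ × ℕ) {c} xs ys →
  (∀ x → weight (map (f x) ys) ≤ c) → weight (cartesianProductWith f xs ys) ≤ length xs * c
weight-cartesianProductWith≤ f []       ys rows≤c = z≤n
weight-cartesianProductWith≤ f (x ∷ xs) ys rows≤c = begin
  weight (map (f x) ys ++ cartesianProductWith f xs ys)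
    ≡⟨ weight-++ (map (f x) ys) _ ⟩
  weight (map (f x) ys) + weight (cartesianProductWith f xs ys)
    ≤⟨ +-mono-≤ (rows≤c x) (weight-cartesianProductWith≤ f xs ys rows≤c) ⟩
  _ + length xs * _
    ∎
  where open ≤-Reasoning

module _ {l K n : ℕ} (R : Fin l → Fin (suc K) → ℕ)
         (R<n : ∀ j t → R j t < n)
         (R-increasing : ∀ j i → R j (inject₁ i) < R j (suc i))
         (R-steps-distinct : ∀ {j j′ i i′} → R j (inject₁ i) ≡ R j′ (inject₁ i′) →
                             R j (suc i) ≡ R j′ (suc i′) → j ≡ j′ × i ≡ i′)
  where

  private
    steps : List (ℕ × ℕ)
    steps = cartesianProductWith (step ∘ R) (allFin l) (allFin K)

    step-injective : ∀ {j j′ i i′} → step (R j) i ≡ step (R j′) i′ → j ≡ j′ × i ≡ i′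
    step-injective {j} {j′} {i} {i′} eq = R-steps-distinct (cong proj₁ eq) (begin
      R j (suc i)              ≡⟨ stepEnd-step (R j) i (R-increasing j i) ⟨
      stepEnd (step (R j) i)   ≡⟨ cong stepEnd eq ⟩
      stepEnd (step (R j′) i′) ≡⟨ stepEnd-step (R j′) i′ (R-increasing j′ i′) ⟩
      R j′ (suc i′)            ∎)
      where open ≡-Reasoning

    steps-bounded : All ((_< n) ∘ proj₁) steps
    steps-bounded = All.tabulate λ q∈steps →
      let (j , i , _ , _ , q≡step) = ∈-cartesianProductWith⁻ (step ∘ R) (allFin l) (allFin K) q∈steps
      in subst ((_< n) ∘ proj₁) (sym q≡step) (R<n j (inject₁ i))

    length-steps : length steps ≡ l * K
    length-steps = trans (length-cartesianProductWith (step ∘ R) (allFin l) (allFin K))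
                         (cong₂ _*_ (length-allFin l) (length-allFin K))

    weight-row≤ : ∀ j → weight (map (step (R j)) (allFin K)) ≤ 2 * n
    weight-row≤ j = begin
      weight (map (step (R j)) (allFin K))          ≡⟨ cong weight (map-tabulate id (step (R j))) ⟩
      weight (tabulate (step (R j)))                ≤⟨ m≤m+n _ _ ⟩
      weight (tabulate (step (R j))) + 2 * R j zero ≤⟨ weight-tabulate-step≤ (R j) (R-increasing j) ⟩
      2 * R j (fromℕ K)                             ≤⟨ *-monoʳ-≤ 2 (<⇒≤ (R<n j (fromℕ K))) ⟩
      2 * n                                         ∎
      where open ≤-Reasoning

    weight-steps≤ : weight steps ≤ l * (2 * n)
    weight-steps≤ = subst (λ m → weight steps ≤ m * (2 * n)) (length-allFin l)
      (weight-cartesianProductWith≤ (step ∘ R) (allFin l) (allFin K) weight-row≤)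

  distinct-steps⇒[lK]²≤2ln² : (l * K) * (l * K) ≤ n * (l * (2 * n))
  distinct-steps⇒[lK]²≤2ln² = begin
    (l * K) * (l * K)                ≡⟨ cong₂ _*_ length-steps length-steps ⟨
    length steps * length steps      ≤⟨ length²≤*weight steps
                                          (cartesianProductWith⁺ _ step-injective (allFin⁺ l) (allFin⁺ K))
                                          steps-bounded ⟩
    n * weight steps                 ≤⟨ *-monoʳ-≤ n weight-steps≤ ⟩
    n * (l * (2 * n))                ∎
    where open ≤-Reasoning

m≤m*m : ∀ m → m ≤ m * m
m≤m*m zero    = z≤n
m≤m*m (suc m) = m≤m*n (suc m) (suc m)

[lK]²≤2ln²⇒[1+K]²l≤9n² : ∀ {l K n} → l ≤ n → (l * K) * (l * K) ≤ n * (l * (2 * n)) →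
                          suc K * suc K * l ≤ 9 * (n * n)
[lK]²≤2ln²⇒[1+K]²l≤9n² {zero}  {K} _ _ = ≤-trans (≤-reflexive (*-zeroʳ (suc K * suc K))) z≤n
[lK]²≤2ln²⇒[1+K]²l≤9n² {l@(suc _)} {K} {n} l≤n [lK]²≤2ln² = begin
  suc K * suc K * l                       ≡⟨ expand K l ⟩
  K * K * l + 2 * (K * l) + l             ≤⟨ +-mono-≤ (+-monoʳ-≤ (K * K * l) (*-monoʳ-≤ 2 (*-monoˡ-≤ l (m≤m*m K))))
                                                      (≤-trans l≤n (m≤m*m n)) ⟩
  K * K * l + 2 * (K * K * l) + n * n     ≤⟨ +-monoˡ-≤ (n * n) (+-mono-≤ K²l≤2n² (*-monoʳ-≤ 2 K²l≤2n²)) ⟩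
  2 * (n * n) + 2 * (2 * (n * n)) + n * n ≤⟨ ≤-reflexive (collect (n * n)) ⟩
  7 * (n * n)                             ≤⟨ *-monoˡ-≤ (n * n) (m≤m+n 7 2) ⟩
  9 * (n * n)                             ∎
  where
  open ≤-Reasoning
  expand : ∀ K l → suc K * suc K * l ≡ K * K * l + 2 * (K * l) + l
  expand = solve-∀
  collect : ∀ m → 2 * m + 2 * (2 * m) + m ≡ 7 * m
  collect = solve-∀
  K²l≤2n² : K * K * l ≤ 2 * (n * n)
  K²l≤2n² = *-cancelˡ-≤ l (subst₂ _≤_ (lhs l K) (rhs l n) [lK]²≤2ln²)
    where
    lhs : ∀ l K → (l * K) * (l * K) ≡ l * (K * K * l)
    lhs = solve-∀
    rhs : ∀ l n → n * (l * (2 * n)) ≡ l * (2 * (n * n))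
    rhs = solve-∀

module Rank {a ℓ} {A : Set a} {_<_ : Rel A ℓ} (<-isStrictTotalOrder : IsStrictTotalOrder _≡_ _<_) where

  open IsStrictTotalOrder <-isStrictTotalOrder
    using (compare; _<?_; irrefl) renaming (trans to <-trans)

  rank : A → List A → ℕ
  rank x cs = length (filter (_<? x) cs)

  rank<length : ∀ {x cs} → x ∈ cs → rank x cs ℕ.< length cs
  rank<length {x} {cs} x∈cs = filter-notAll (_<? x) cs (Any.map (λ { refl → irrefl refl }) x∈cs)

  rank-mono : ∀ {x y} → x < y → ∀ cs → rank x cs ≤ rank y cs
  rank-mono {x} {y} x<y cs =
    length-mono-≤ (filter⁺ (_<? x) (_<? y) (λ { refl c<x → <-trans c<x x<y }) (⊆-refl {x = cs}))

  rank-strictMono : ∀ {x y cs} → x < y → x ∈ cs → rank x cs ℕ.< rank y cs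
  rank-strictMono {x} {y} x<y (here {xs = cs} refl)
    rewrite filter-reject (_<? x) {xs = cs} (irrefl refl) | filter-accept (_<? y) {xs = cs} x<y =
    s≤s (rank-mono x<y cs)
  rank-strictMono {x} {y} x<y (there {x = c} x∈cs) with c <? x | c <? y
  ... | yes _   | yes _   = s≤s (rank-strictMono x<y x∈cs)
  ... | yes c<x | no  c≮y = contradiction (<-trans c<x x<y) c≮y
  ... | no  _   | yes _   = m≤n⇒m≤1+n (rank-strictMono x<y x∈cs)
  ... | no  _   | no  _   = rank-strictMono x<y x∈cs

  rank-injective : ∀ {x y cs} → x ∈ cs → y ∈ cs → rank x cs ≡ rank y cs → x ≡ y
  rank-injective {x} {y} x∈cs y∈cs eq with compare x y
  ... | tri< x<y _ _ = contradiction eq (<⇒≢ (rank-strictMono x<y x∈cs))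
  ... | tri≈ _ x≡y _ = x≡y
  ... | tri> _ _ y<x = contradiction (sym eq) (<⇒≢ (rank-strictMono y<x y∈cs))

module _ {a ℓ} (G : AbelianGroup a ℓ) where

  open AbelianGroup G
    using (_≈_; _∙_; _⁻¹; _-_; ε; setoid; ∙-congˡ; inverseʳ; identityʳ; commutativeSemigroup)
  open AbelianGroupProperties G using (⁻¹-∙-comm)
  open CommutativeSemigroupProperties commutativeSemigroup using (interchange)
  open import Relation.Binary.Reasoning.Setoid setoid

  [x∙z]-[y∙z]≈x-y : ∀ x y z → (x ∙ z) - (y ∙ z) ≈ x - y
  [x∙z]-[y∙z]≈x-y x y z = begin
    (x ∙ z) ∙ (y ∙ z) ⁻¹       ≈⟨ ∙-congˡ (⁻¹-∙-comm y z) ⟨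
    (x ∙ z) ∙ (y ⁻¹ ∙ z ⁻¹)    ≈⟨ interchange x z (y ⁻¹) (z ⁻¹) ⟩
    (x ∙ y ⁻¹) ∙ (z ∙ z ⁻¹)    ≈⟨ ∙-congˡ (inverseʳ z) ⟩
    (x ∙ y ⁻¹) ∙ ε             ≈⟨ identityʳ _ ⟩
    x - y                      ∎

module SumsetRanks
  (ℝ : RealNumbers)
  {K l} {a : Fin (suc K) → RealNumbers.Carrier ℝ} {b : Fin l → RealNumbers.Carrier ℝ}
  {C : List (RealNumbers.Carrier ℝ)}
  (a-increasing : StrictlyIncreasing ℝ a) (a-distinctDiffs : DistinctConsecutiveDifferences ℝ a)
  (b-injective : Injective _≡_ _≡_ b) (C-enumerates : EnumeratesSumset ℝ a b C)
  where

  open RealNumbers ℝ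
    using (-_; 0ᵣ; 1ᵣ; isCommutativeRing; isStrictTotalOrder; +-mono-<)
    renaming (_+_ to _+ᵣ_; _·_ to _·ᵣ_; _-_ to _-ᵣ_)
  open Rank isStrictTotalOrder

  +-abelianGroup : AbelianGroup _ _
  +-abelianGroup = CommutativeRing.+-abelianGroup (record
    { _≈_ = _≡_ ; _+_ = _+ᵣ_ ; _*_ = _·ᵣ_ ; -_ = -_ ; 0# = 0ᵣ ; 1# = 1ᵣ
    ; isCommutativeRing = isCommutativeRing })

  open AbelianGroupProperties +-abelianGroup using (∙-cancelˡ)

  sum∈C : ∀ t j → a t +ᵣ b j ∈ C
  sum∈C t j = proj₂ (proj₂ C-enumerates (a t +ᵣ b j)) t j

  R : Fin l → Fin (suc K) → ℕ
  R j t = rank (a t +ᵣ b j) C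

  R<|C| : ∀ j t → R j t < length C
  R<|C| j t = rank<length (sum∈C t j)

  R-increasing : ∀ j i → R j (inject₁ i) < R j (suc i)
  R-increasing j i = rank-strictMono
    (+-mono-< (b j) (a-increasing (inject₁ i) (suc i) (≤-reflexive (cong suc (toℕ-inject₁ i)))))
    (sum∈C (inject₁ i) j)

  consecDiff≡ : ∀ i → consecDiff ℝ a (toℕ i) (s≤s (toℕ<n i)) ≡ a (suc i) -ᵣ a (inject₁ i)
  consecDiff≡ i = cong₂ _-ᵣ_ (cong a (fromℕ<-toℕ (suc i) (s≤s (toℕ<n i))))
                             (cong a (toℕ-injective (trans (toℕ-fromℕ< _) (sym (toℕ-inject₁ i)))))

  a-diff-injective : ∀ {i i′} → a (suc i) -ᵣ a (inject₁ i) ≡ a (suc i′) -ᵣ a (inject₁ i′) → i ≡ i′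
  a-diff-injective {i} {i′} eq = toℕ-injective
    (a-distinctDiffs (toℕ i) (toℕ i′) (s≤s (toℕ<n i)) (s≤s (toℕ<n i′))
      (trans (consecDiff≡ i) (trans eq (sym (consecDiff≡ i′)))))

  sum-injectiveʳ : ∀ t {j j′} → a t +ᵣ b j ≡ a t +ᵣ b j′ → j ≡ j′
  sum-injectiveʳ t eq = b-injective (∙-cancelˡ _ _ _ eq)

  sum-steps-distinct : ∀ {j j′ i i′} → a (inject₁ i) +ᵣ b j ≡ a (inject₁ i′) +ᵣ b j′ →
                       a (suc i) +ᵣ b j ≡ a (suc i′) +ᵣ b j′ → j ≡ j′ × i ≡ i′
  sum-steps-distinct {j} {j′} {i} {i′} start end = j≡j′ , i≡i′
    where
    diffs≡ : a (suc i) -ᵣ a (inject₁ i) ≡ a (suc i′) -ᵣ a (inject₁ i′)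
    diffs≡ = begin
      a (suc i) -ᵣ a (inject₁ i)                      ≡⟨ [x∙z]-[y∙z]≈x-y +-abelianGroup _ _ (b j) ⟨
      (a (suc i) +ᵣ b j) -ᵣ (a (inject₁ i) +ᵣ b j)     ≡⟨ cong₂ _-ᵣ_ end start ⟩
      (a (suc i′) +ᵣ b j′) -ᵣ (a (inject₁ i′) +ᵣ b j′) ≡⟨ [x∙z]-[y∙z]≈x-y +-abelianGroup _ _ (b j′) ⟩
      a (suc i′) -ᵣ a (inject₁ i′)                    ∎
      where open ≡-Reasoning
    i≡i′ : i ≡ i′
    i≡i′ = a-diff-injective diffs≡
    j≡j′ : j ≡ j′
    j≡j′ = sum-injectiveʳ (inject₁ i) (trans start (cong (λ t → a (inject₁ t) +ᵣ b j′) (sym i≡i′)))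

  R-steps-distinct : ∀ {j j′ i i′} → R j (inject₁ i) ≡ R j′ (inject₁ i′) →
                     R j (suc i) ≡ R j′ (suc i′) → j ≡ j′ × i ≡ i′
  R-steps-distinct start≡ end≡ = sum-steps-distinct
    (rank-injective (sum∈C _ _) (sum∈C _ _) start≡) (rank-injective (sum∈C _ _) (sum∈C _ _) end≡)

  l≤|C| : l ≤ length C
  l≤|C| = injective⇒≤ {f = λ j → fromℕ< (R<|C| j zero)}
    (λ eq → sum-injectiveʳ zero (rank-injective (sum∈C _ _) (sum∈C _ _) (fromℕ<-injective _ _ _ _ eq)))

theorem1 : (ℝ : RealNumbers) → (k l : ℕ) →
           (a : Fin k → RealNumbers.Carrier ℝ) → (b : Fin l → RealNumbers.Carrier ℝ) →
           StrictlyIncreasing ℝ a → DistinctConsecutiveDifferences ℝ a →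
           Injective _≡_ _≡_ b →
           (C : List (RealNumbers.Carrier ℝ)) → EnumeratesSumset ℝ a b C →
           k * k * l ≤ 9 * (length C * length C)
theorem1 ℝ zero    l a b _ _ _ C _ = z≤n
theorem1 ℝ (suc K) l a b a-increasing a-distinctDiffs b-injective C C-enumerates =
  [lK]²≤2ln²⇒[1+K]²l≤9n² l≤|C| (distinct-steps⇒[lK]²≤2ln² R R<|C| R-increasing R-steps-distinct)
  where open SumsetRanks ℝ a-increasing a-distinctDiffs b-injective C-enumerates
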